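{- Let $F$ be a fragment of first-order logic that enjoys Craig interpolation, let $\Sigma$ be a signature and let $\varphi_1,\varphi_2$ be $F$-sentences. If $\varphi_1$ $F(\Sigma)$-entails $\varphi_2$, then $\varphi_1$ strongly $F(\Sigma)$-entails $\varphi_2$. In particular, if $\varphi_2\models\varphi_1$ and $\mathsf{sig}(\varphi_1)\subseteq\Sigma$, then $\varphi_1$ is a uniform $F(\Sigma)$-interpolant of $\varphi_2$ if and only if $\varphi_1$ $F(\Sigma)$-entails $\varphi_2$.
   Context: All logics are fragments of first-order logic (FO) over relational signatures, with equality, without constants and function symbols. A signature is a finite set of predicates; equality is a logical symbol and never part of a signature. $\mathsf{sig}(\varphi)$ is the set of predicates occurring in $\varphi$, and $F(\Sigma)$ is the set of $F$-sentences using only predicates from $\Sigma$ (and possibly equality). For $F$-sentences $\varphi_1,\varphi_2$: $\varphi_1$ $F(\Sigma)$-entails $\varphi_2$ if for every $F(\Sigma)$-sentence $\psi$, $\varphi_2\models\psi$ implies $\varphi_1\models\psi$. $\varphi_1$ strongly $F(\Sigma)$-entails $\varphi_2$ if $\varphi_1$ $F(\Sigma')$-entails $\varphi_2$ for every signature $\Sigma'$ with $\Sigma'\cap\mathsf{sig}(\varphi_2)\subseteq\Sigma$. $F$ has Craig interpolation if for all $F$-sentences $\psi_1,\psi_2$ with $\psi_1\models\psi_2$ there is an $F$-sentence $\psi$ with $\psi_1\models\psi\models\psi_2$ and $\mathsf{sig}(\psi)\subseteq\mathsf{sig}(\psi_1)\cap\mathsf{sig}(\psi_2)$. Given an $F$-sentence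 $\psi_1$ and an $F$-sentence $\psi$ with $\psi_1\models\psi$ and $\mathsf{sig}(\psi)\subseteq\Sigma$, $\psi$ is a uniform $F(\Sigma)$-interpolant of $\psi_1$ iff $\psi$ strongly $F(\Sigma)$-entails $\psi_1$ (equivalently: for every $F$-sentence $\chi$ with $\mathsf{sig}(\chi)\cap\mathsf{sig}(\psi_1)\subseteq\Sigma$ and $\psi_1\models\chi$ one has $\psi\models\chi$). -}

module Defs where

open import Data.Nat using (ℕ; suc)
open import Data.Fin using (Fin; zero; suc)
open import Data.Vec using (Vec; map)
open import Data.List using (List; []; _∷_; _++_)
open import Data.List.Membership.Propositional using (_∈_)
open import Data.Product using (Σ; _×_; proj₂)
open import Data.Sum using (_⊎_)
open import Data.Empty using (⊥)
open import Relation.Binary.PropositionalEquality using (_≡_)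

-- A predicate symbol: a name together with its arity.
Pred : Set
Pred = ℕ × ℕ

arity : Pred → ℕ
arity = proj₂

Signature : Set
Signature = List Pred

-- Formulas with free variables among Fin n (de Bruijn indices).
data Formula (n : ℕ) : Set where
  rel  : (P : Pred) → Vec (Fin n) (arity P) → Formula n
  eqv  : Fin n → Fin n → Formula n
  ff   : Formula n
  tt   : Formula n
  neg  : Formula n → Formula n
  conj : Formula n → Formula n → Formula n
  disj : Formula n → Formula n → Formula n
  impl : Formula n → Formula n → Formula n
  all  : Formula (suc n) → Formula n
  ex   : Formula (suc n) → Formula n

Sentence : Set
Sentence = Formula 0

sig : ∀ {n} → Formula n → Signature
sig (rel P _)    = P ∷ []
sig (eqv _ _)    = []
sig ff           = []
sig tt           = []
sig (neg φ)      = sig φ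
sig (conj φ ψ)   = sig φ ++ sig ψ
sig (disj φ ψ)   = sig φ ++ sig ψ
sig (impl φ ψ)   = sig φ ++ sig ψ
sig (all φ)      = sig φ
sig (ex φ)       = sig φ

_⊆ₛ_ : Signature → Signature → Set
S ⊆ₛ T = ∀ P → P ∈ S → P ∈ T

-- Structures: nonempty domain, interpretation of every predicate symbol.
record Structure : Set₁ where
  field
    Dom   : Set
    point : Dom
    interp : (P : Pred) → Vec Dom (arity P) → Set
open Structure public

Env : Structure → ℕ → Set
Env M n = Fin n → Dom M

extend : ∀ {M : Structure} {n} → Dom M → Env M n → Env M (suc n)
extend d ρ zero    = d
extend d ρ (suc i) = ρ i

Sat : (M : Structure) → ∀ {n} → Env M n → Formula n → Set
Sat M ρ (rel P xs)  = interp M P (map ρ xs)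
Sat M ρ (eqv x y)   = ρ x ≡ ρ y
Sat M ρ ff          = ⊥
Sat M ρ tt          = ⊥ → ⊥
Sat M ρ (neg φ)     = Sat M ρ φ → ⊥
Sat M ρ (conj φ ψ)  = Sat M ρ φ × Sat M ρ ψ
Sat M ρ (disj φ ψ)  = Sat M ρ φ ⊎ Sat M ρ ψ
Sat M ρ (impl φ ψ)  = Sat M ρ φ → Sat M ρ ψ
Sat M ρ (all φ)     = (d : Dom M) → Sat M (extend {M} d ρ) φ
Sat M ρ (ex φ)      = Σ (Dom M) (λ d → Sat M (extend {M} d ρ) φ)

emptyEnv : ∀ {M : Structure} → Env M 0
emptyEnv ()

_⊨ˢ_ : Structure → Sentence → Set
M ⊨ˢ φ = Sat M (emptyEnv {M}) φ

_⊨_ : Sentence → Sentence → Set₁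
φ ⊨ ψ = (M : Structure) → M ⊨ˢ φ → M ⊨ˢ ψ

Fragment : Set₁
Fragment = Sentence → Set

CraigInterpolation : Fragment → Set₁
CraigInterpolation F =
  ∀ ψ₁ ψ₂ → F ψ₁ → F ψ₂ → ψ₁ ⊨ ψ₂ →
  Σ Sentence (λ ψ → F ψ × ψ₁ ⊨ ψ × ψ ⊨ ψ₂ ×
                    (∀ P → P ∈ sig ψ → P ∈ sig ψ₁ × P ∈ sig ψ₂))

FEntails : Fragment → Signature → Sentence → Sentence → Set₁
FEntails F S φ₁ φ₂ = ∀ ψ → F ψ → sig ψ ⊆ₛ S → φ₂ ⊨ ψ → φ₁ ⊨ ψ

StronglyFEntails : Fragment → Signature → Sentence → Sentence → Set₁
StronglyFEntails F S φ₁ φ₂ =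
  ∀ (S' : Signature) → (∀ P → P ∈ S' → P ∈ sig φ₂ → P ∈ S) → FEntails F S' φ₁ φ₂

UniformInterpolant : Fragment → Signature → Sentence → Sentence → Set₁
UniformInterpolant F S ψ ψ₁ =
  ψ₁ ⊨ ψ × sig ψ ⊆ₛ S ×
  (∀ χ → F χ → (∀ P → P ∈ sig χ → P ∈ sig ψ₁ → P ∈ S) → ψ₁ ⊨ χ → ψ ⊨ χ)

-- Given ψ of F over Σ' with φ₂ ⊨ ψ, a Craig interpolant θ of φ₂ ⊨ ψ uses only
-- predicates shared by φ₂ and ψ, and these lie in Σ by the hypothesis on Σ'.
-- So F(Σ)-entailment applies to θ, giving φ₁ ⊨ θ ⊨ ψ.
module Submission where

open import Defs
open import Data.Product using (_×_; _,_; proj₁; proj₂)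
open import Function.Bundles using (_⇔_; mk⇔)

FEntails⇒StronglyFEntails : (F : Fragment) → CraigInterpolation F →
  (S : Signature) (φ₁ φ₂ : Sentence) → F φ₂ →
  FEntails F S φ₁ φ₂ → StronglyFEntails F S φ₁ φ₂
FEntails⇒StronglyFEntails F craig S φ₁ φ₂ Fφ₂ entails S' shared⊆S ψ Fψ sigψ⊆S' φ₂⊨ψ M M⊨φ₁
  with craig φ₂ ψ Fφ₂ Fψ φ₂⊨ψ
... | θ , Fθ , φ₂⊨θ , θ⊨ψ , sigθ⊆both = θ⊨ψ M (entails θ Fθ sigθ⊆S φ₂⊨θ M M⊨φ₁)
  where
  sigθ⊆S : sig θ ⊆ₛ S
  sigθ⊆S P P∈θ = shared⊆S P (sigψ⊆S' P (proj₂ (sigθ⊆both P P∈θ))) (proj₁ (sigθ⊆both P P∈θ))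

uniformInterpolant⇒FEntails : (F : Fragment) (S : Signature) (φ₁ φ₂ : Sentence) →
  UniformInterpolant F S φ₁ φ₂ → FEntails F S φ₁ φ₂
uniformInterpolant⇒FEntails F S φ₁ φ₂ (_ , _ , uniform) ψ Fψ sigψ⊆S =
  uniform ψ Fψ (λ P P∈ψ _ → sigψ⊆S P P∈ψ)

StronglyFEntails⇒uniformInterpolant : (F : Fragment) (S : Signature) (φ₁ φ₂ : Sentence) →
  φ₂ ⊨ φ₁ → sig φ₁ ⊆ₛ S →
  StronglyFEntails F S φ₁ φ₂ → UniformInterpolant F S φ₁ φ₂
StronglyFEntails⇒uniformInterpolant F S φ₁ φ₂ φ₂⊨φ₁ sigφ₁⊆S strongly =
  φ₂⊨φ₁ , sigφ₁⊆S , λ χ Fχ shared⊆S → strongly (sig χ) shared⊆S χ Fχ (λ _ P∈χ → P∈χ)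

theorem5 : (F : Fragment) → CraigInterpolation F →
    (S : Signature) (φ₁ φ₂ : Sentence) → F φ₁ → F φ₂ →
    (FEntails F S φ₁ φ₂ → StronglyFEntails F S φ₁ φ₂) ×
    (φ₂ ⊨ φ₁ → sig φ₁ ⊆ₛ S → (UniformInterpolant F S φ₁ φ₂ ⇔ FEntails F S φ₁ φ₂))
theorem5 F craig S φ₁ φ₂ _ Fφ₂ =
  strengthen ,
  λ φ₂⊨φ₁ sigφ₁⊆S → mk⇔
    (uniformInterpolant⇒FEntails F S φ₁ φ₂)
    (λ entails → StronglyFEntails⇒uniformInterpolant F S φ₁ φ₂ φ₂⊨φ₁ sigφ₁⊆S (strengthen entails))
  where
  strengthen : FEntails F S φ₁ φ₂ → StronglyFEntails F S φ₁ φ₂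
  strengthen = FEntails⇒StronglyFEntails F craig S φ₁ φ₂ Fφ₂
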